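{- Let $N\ge1$. Let $f_{\mathrm{prod}}:\mathbb{N}^N\to\mathbb{N}$, $f_{\mathrm{prod}}(\mathbf{s})=s_1s_2\cdots s_N$, and let $g$ be the indicator function of $\{1,2\}^N=\{(s_1,\dots,s_N): s_i\in\{1,2\}\}$. Then for every integer $\ell>0$, $$c_{f_{\mathrm{prod}}}(\ell\mathbf{1})=c_g((2\ell-1)\mathbf{1}),$$ where $\mathbf{1}=(1,\dots,1)\in\mathbb{N}^N$.
   Context: $\mathbb{N}=\{0,1,2,\dots\}$. For $h:\mathbb{N}^N\to\mathbb{N}$, $k\ge0$ and $\boldsymbol{\ell}\in\mathbb{N}^N$, $\binom{k}{\boldsymbol{\ell}}_h=\sum h(\mathbf{m}_1)\cdots h(\mathbf{m}_k)$ over all ordered $k$-tuples of vectors $\mathbf{m}_j\in\mathbb{N}^N$ with $\mathbf{m}_1+\cdots+\mathbf{m}_k=\boldsymbol{\ell}$, and $c_h(\boldsymbol{\ell})=\sum_{k\ge0}\binom{k}{\boldsymbol{\ell}}_h$, the number of $h$-weighted vector compositions of $\boldsymbol{\ell}$ (each part of value $\mathbf{m}$ colored in one of $h(\mathbf{m})$ colors) with any number of parts. -}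

module Defs where

open import Data.Nat using (ℕ; zero; suc; _+_; _*_; _≤_)
open import Data.List using (List; []; _∷_; map; concatMap; upTo)
open import Data.Nat.ListAction using (sum)
open import Data.Vec using (Vec; []; _∷_; replicate; zipWith; foldr)
open import Data.Bool using (Bool; true; false; _∧_)
open import Relation.Nullary.Decidable using (⌊_⌋)
import Data.Vec.Properties
open import Data.Vec.Properties using (≡-dec)
import Data.Nat as ℕ

below : ∀ {N} → Vec ℕ N → List (Vec ℕ N)
below []      = []  ∷ []
below (x ∷ v) = concatMap (λ a → map (a ∷_) (below v)) (upTo (suc x))

_-ᵥ_ : ∀ {N} → Vec ℕ N → Vec ℕ N → Vec ℕ N
_-ᵥ_ = zipWith ℕ._∸_

-- binom k ℓ_h = Σ h(m₁)⋯h(m_k) over ordered k-tuples (m₁,…,m_k) in ℕ^N with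
-- m₁ + ⋯ + m_k = ℓ.
binom : ∀ {N} → (Vec ℕ N → ℕ) → ℕ → Vec ℕ N → ℕ
binom {N} h zero    ℓ = if ⌊ ≡-dec ℕ._≟_ ℓ (replicate N 0) ⌋ then 1 else 0
  where open import Data.Bool using (if_then_else_)
binom h (suc k) ℓ = sum (map (λ m → h m * binom h k (ℓ -ᵥ m)) (below ℓ))

cPartial : ∀ {N} → (Vec ℕ N → ℕ) → ℕ → Vec ℕ N → ℕ
cPartial h zero    ℓ = binom h zero ℓ
cPartial h (suc K) ℓ = cPartial h K ℓ + binom h (suc K) ℓ

-- c_h(ℓ) = Σ_{k≥0} binom k ℓ_h = a  (the series of naturals converges to a,
-- i.e. its partial sums are eventually equal to a)
HasSum : ∀ {N} → (Vec ℕ N → ℕ) → Vec ℕ N → ℕ → Set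
HasSum h ℓ a = Σ ℕ λ K₀ → ∀ K → K₀ ≤ K → cPartial h K ℓ ≡ a
  where open import Data.Product using (Σ)
        open import Relation.Binary.PropositionalEquality using (_≡_)

fprod : ∀ {N} → Vec ℕ N → ℕ
fprod = foldr _ _*_ 1

in12 : ℕ → Bool
in12 1 = true
in12 2 = true
in12 _ = false

g : ∀ {N} → Vec ℕ N → ℕ
g v = if foldr _ (λ x b → in12 x ∧ b) true v then 1 else 0
  where open import Data.Bool using (if_then_else_)

𝟏 : (N : ℕ) → Vec ℕ N
𝟏 N = replicate N 1

_·ᵥ_ : ∀ {N} → ℕ → Vec ℕ N → Vec ℕ N
c ·ᵥ v = Data.Vec.map (c *_) v

-- A product weight on ℕ^N makes the count of k-part compositions of a vector
-- the product of the one-dimensional counts of its coordinates, so on the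
-- diagonal both sides are power sums Σ_k b(k)^N of one-dimensional counts.
-- With weight a the count of k-part compositions of x is the coefficient of
-- t^x in (t/(1-t)²)^k, namely C(x+k-1, 2k-1); with the indicator of {1,2} it
-- is the coefficient of t^x in (t+t²)^k, namely C(k, 2k-x).  For x = ℓ and
-- k = i+1 on the one side, x = 2ℓ-1 and k = ℓ+i on the other, both counts are
-- C(ℓ+i, 2i+1), and all remaining terms vanish.
module Submission where

open import Defs
open import Data.Nat using (ℕ; zero; suc; _+_; _*_; _∸_; _^_; _≤_; _<_; z≤n; s≤s; _≟_)
open import Data.Nat.Properties
open import Data.Nat.Combinatorics using (_C_; k>n⇒nCk≡0; nCk+nC[k+1]≡[n+1]C[k+1])
open import Data.Nat.ListAction using (sum)
open import Data.Nat.ListAction.Properties using (sum-++)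
open import Data.Nat.Tactic.RingSolver using (solve-∀)
import Algebra.Properties.CommutativeSemigroup as CommSemigroupProperties
open import Data.Product using (Σ; _×_; _,_)
open import Data.List using (List; []; _∷_; _++_; map; concatMap; upTo; applyUpTo)
open import Data.List.Properties using (map-cong; map-∘; map-++; map-upTo)
open import Data.Vec using (Vec; []; _∷_; replicate; foldr)
open import Data.Vec.Properties using (≡-dec)
open import Data.Bool using (if_then_else_)
open import Relation.Nullary.Decidable using (yes; no)
open import Function using (id; _∘_)
open import Relation.Binary.PropositionalEquality
open ≡-Reasoning
open CommSemigroupProperties +-commutativeSemigroup using () renaming (interchange to +-interchange)
open CommSemigroupProperties *-commutativeSemigroup using () renaming (interchange to *-interchange)

sum-map-+ : ∀ {A : Set} (f g : A → ℕ) xs →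
  sum (map (λ a → f a + g a) xs) ≡ sum (map f xs) + sum (map g xs)
sum-map-+ f g [] = refl
sum-map-+ f g (x ∷ xs) = trans (cong (f x + g x +_) (sum-map-+ f g xs))
                               (+-interchange (f x) (g x) _ _)

sum-map-*ˡ : ∀ {A : Set} c (f : A → ℕ) xs → sum (map (λ a → c * f a) xs) ≡ c * sum (map f xs)
sum-map-*ˡ c f [] = sym (*-zeroʳ c)
sum-map-*ˡ c f (x ∷ xs) = trans (cong (c * f x +_) (sum-map-*ˡ c f xs)) (sym (*-distribˡ-+ c (f x) _))

sum-map-*ʳ : ∀ {A : Set} c (f : A → ℕ) xs → sum (map (λ a → f a * c) xs) ≡ sum (map f xs) * c
sum-map-*ʳ c f xs = trans (cong sum (map-cong (λ a → *-comm (f a) c) xs))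
                          (trans (sum-map-*ˡ c f xs) (*-comm c _))

sum-map-applyUpTo-zero : ∀ (f h : ℕ → ℕ) → (∀ a → f (h a) ≡ 0) → ∀ n → sum (map f (applyUpTo h n)) ≡ 0
sum-map-applyUpTo-zero f h f∘h≡0 zero    = refl
sum-map-applyUpTo-zero f h f∘h≡0 (suc n) =
  cong₂ _+_ (f∘h≡0 0) (sum-map-applyUpTo-zero f (h ∘ suc) (f∘h≡0 ∘ suc) n)

sum-map-concatMap : ∀ {A B : Set} (F : B → ℕ) (G : A → List B) xs →
  sum (map F (concatMap G xs)) ≡ sum (map (λ a → sum (map F (G a))) xs)
sum-map-concatMap F G [] = refl
sum-map-concatMap F G (x ∷ xs) = begin
  sum (map F (G x ++ concatMap G xs))                ≡⟨ cong sum (map-++ F (G x) _) ⟩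
  sum (map F (G x) ++ map F (concatMap G xs))        ≡⟨ sum-++ (map F (G x)) _ ⟩
  sum (map F (G x)) + sum (map F (concatMap G xs))   ≡⟨ cong (_ +_) (sum-map-concatMap F G xs) ⟩
  sum (map F (G x)) + sum (map (λ a → sum (map F (G a))) xs) ∎

sum-upTo-suc : ∀ (f : ℕ → ℕ) n → sum (map f (upTo (suc n))) ≡ f 0 + sum (map (f ∘ suc) (upTo n))
sum-upTo-suc f n = cong sum (trans (map-upTo f (suc n)) (cong (f 0 ∷_) (sym (map-upTo (f ∘ suc) n))))

sum-below-∷ : ∀ {N} (F : Vec ℕ (suc N) → ℕ) x (v : Vec ℕ N) →
  sum (map F (below (x ∷ v))) ≡ sum (map (λ a → sum (map (λ m → F (a ∷ m)) (below v))) (upTo (suc x)))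
sum-below-∷ F x v = trans (sum-map-concatMap F (λ a → map (a ∷_) (below v)) (upTo (suc x)))
  (cong sum (map-cong (λ a → cong sum (sym (map-∘ (below v)))) (upTo (suc x))))

binom₁ : (ℕ → ℕ) → ℕ → ℕ → ℕ
binom₁ φ zero    zero    = 1
binom₁ φ zero    (suc _) = 0
binom₁ φ (suc k) x       = sum (map (λ a → φ a * binom₁ φ k (x ∸ a)) (upTo (suc x)))

∏ : ∀ {N} → (ℕ → ℕ) → Vec ℕ N → ℕ
∏ φ = foldr _ (λ x r → φ x * r) 1

binom-zero-∷ : ∀ {N} φ x (v : Vec ℕ N) → binom (∏ φ) 0 (x ∷ v) ≡ binom₁ φ 0 x * binom (∏ φ) 0 v
binom-zero-∷ {N} φ zero v with ≡-dec _≟_ v (replicate N 0)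
... | yes _ = refl
... | no  _ = refl
binom-zero-∷ φ (suc x) v = refl

binom-∏ : ∀ {N} φ k (v : Vec ℕ N) → binom (∏ φ) k v ≡ ∏ (binom₁ φ k) v
binom-∏ φ zero    []      = refl
binom-∏ φ zero    (x ∷ v) = trans (binom-zero-∷ φ x v) (cong (binom₁ φ 0 x *_) (binom-∏ φ zero v))
binom-∏ φ (suc k) []      = trans (+-identityʳ _) (trans (+-identityʳ _) (binom-∏ φ k []))
binom-∏ φ (suc k) (x ∷ v) = begin
  binom (∏ φ) (suc k) (x ∷ v)
    ≡⟨ sum-below-∷ _ x v ⟩
  sum (map (λ a → sum (map (λ m → (φ a * ∏ φ m) * binom (∏ φ) k ((x ∸ a) ∷ (v -ᵥ m))) (below v))) (upTo (suc x)))
    ≡⟨ cong sum (map-cong separate (upTo (suc x))) ⟩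
  sum (map (λ a → (φ a * binom₁ φ k (x ∸ a)) * binom (∏ φ) (suc k) v) (upTo (suc x)))
    ≡⟨ sum-map-*ʳ _ (λ a → φ a * binom₁ φ k (x ∸ a)) (upTo (suc x)) ⟩
  binom₁ φ (suc k) x * binom (∏ φ) (suc k) v
    ≡⟨ cong (binom₁ φ (suc k) x *_) (binom-∏ φ (suc k) v) ⟩
  binom₁ φ (suc k) x * ∏ (binom₁ φ (suc k)) v ∎
  where
  separate : ∀ a →
    sum (map (λ m → (φ a * ∏ φ m) * binom (∏ φ) k ((x ∸ a) ∷ (v -ᵥ m))) (below v))
      ≡ (φ a * binom₁ φ k (x ∸ a)) * binom (∏ φ) (suc k) v
  separate a = trans (cong sum (map-cong term (below v)))
                     (sum-map-*ˡ (φ a * binom₁ φ k (x ∸ a)) (λ m → ∏ φ m * binom (∏ φ) k (v -ᵥ m)) (below v))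
    where
    term : ∀ m → (φ a * ∏ φ m) * binom (∏ φ) k ((x ∸ a) ∷ (v -ᵥ m))
               ≡ (φ a * binom₁ φ k (x ∸ a)) * (∏ φ m * binom (∏ φ) k (v -ᵥ m))
    term m = begin
      (φ a * ∏ φ m) * binom (∏ φ) k ((x ∸ a) ∷ (v -ᵥ m))
        ≡⟨ cong ((φ a * ∏ φ m) *_) (binom-∏ φ k ((x ∸ a) ∷ (v -ᵥ m))) ⟩
      (φ a * ∏ φ m) * (binom₁ φ k (x ∸ a) * ∏ (binom₁ φ k) (v -ᵥ m))
        ≡⟨ cong (λ z → (φ a * ∏ φ m) * (binom₁ φ k (x ∸ a) * z)) (binom-∏ φ k (v -ᵥ m)) ⟨
      (φ a * ∏ φ m) * (binom₁ φ k (x ∸ a) * binom (∏ φ) k (v -ᵥ m))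
        ≡⟨ *-interchange (φ a) (∏ φ m) (binom₁ φ k (x ∸ a)) _ ⟩
      (φ a * binom₁ φ k (x ∸ a)) * (∏ φ m * binom (∏ φ) k (v -ᵥ m)) ∎

∏-diagonal : ∀ (F : ℕ → ℕ) c N → ∏ F (c ·ᵥ 𝟏 N) ≡ F c ^ N
∏-diagonal F c zero    = refl
∏-diagonal F c (suc N) = cong₂ _*_ (cong F (*-identityʳ c)) (∏-diagonal F c N)

binom-∏-diagonal : ∀ φ k c N → binom (∏ φ) k (c ·ᵥ 𝟏 N) ≡ binom₁ φ k c ^ N
binom-∏-diagonal φ k c N = trans (binom-∏ φ k (c ·ᵥ 𝟏 N)) (∏-diagonal (binom₁ φ k) c N)

prefixSum : (ℕ → ℕ) → ℕ → ℕ
prefixSum f x = sum (map (λ a → f (x ∸ a)) (upTo (suc x)))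

prefixSum-suc : ∀ f x → prefixSum f (suc x) ≡ f (suc x) + prefixSum f x
prefixSum-suc f x = sum-upTo-suc (λ a → f (suc x ∸ a)) (suc x)

-- Writing the first part as a + 1, the weight (a + 1)·c = c + a·c splits the sum in two.
binom₁-id-suc : ∀ k x → binom₁ id (suc k) (suc x) ≡ prefixSum (binom₁ id k) x + binom₁ id (suc k) x
binom₁-id-suc k x = trans (sum-upTo-suc (λ a → a * binom₁ id k (suc x ∸ a)) (suc x))
  (sum-map-+ (λ a → binom₁ id k (x ∸ a)) (λ a → a * binom₁ id k (x ∸ a)) (upTo (suc x)))

binom₁-id-closed-step : ∀ k → (∀ x → prefixSum (binom₁ id k) x ≡ (x + k) C (k + k)) →
  ∀ x → binom₁ id (suc k) x ≡ (x + k) C suc (k + k)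
binom₁-id-closed-step k prefix zero = sym (k>n⇒nCk≡0 (s≤s (m≤m+n k k)))
binom₁-id-closed-step k prefix (suc x) = begin
  binom₁ id (suc k) (suc x)                                 ≡⟨ binom₁-id-suc k x ⟩
  prefixSum (binom₁ id k) x + binom₁ id (suc k) x           ≡⟨ cong₂ _+_ (prefix x) (binom₁-id-closed-step k prefix x) ⟩
  (x + k) C (k + k) + (x + k) C suc (k + k)                 ≡⟨ nCk+nC[k+1]≡[n+1]C[k+1] (x + k) (k + k) ⟩
  suc (x + k) C suc (k + k)                                 ∎

prefixSum-binom₁-id-closed-step : ∀ k → (∀ x → binom₁ id (suc k) x ≡ (x + k) C suc (k + k)) →
  ∀ x → prefixSum (binom₁ id (suc k)) x ≡ (x + suc k) C (suc k + suc k)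
prefixSum-binom₁-id-closed-step k closed zero = sym (k>n⇒nCk≡0 (s≤s (m≤n+m (suc k) k)))
prefixSum-binom₁-id-closed-step k closed (suc x) = begin
  prefixSum (binom₁ id (suc k)) (suc x)
    ≡⟨ prefixSum-suc (binom₁ id (suc k)) x ⟩
  binom₁ id (suc k) (suc x) + prefixSum (binom₁ id (suc k)) x
    ≡⟨ cong₂ _+_ (closed (suc x)) (prefixSum-binom₁-id-closed-step k closed x) ⟩
  suc (x + k) C suc (k + k) + (x + suc k) C (suc k + suc k)
    ≡⟨ cong₂ (λ n r → suc (x + k) C suc (k + k) + n C suc r) (+-suc x k) (+-suc k k) ⟩
  suc (x + k) C suc (k + k) + suc (x + k) C suc (suc (k + k))
    ≡⟨ nCk+nC[k+1]≡[n+1]C[k+1] (suc (x + k)) (suc (k + k)) ⟩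
  suc (suc (x + k)) C suc (suc (k + k))
    ≡⟨ cong₂ (λ n r → suc n C suc r) (+-suc x k) (+-suc k k) ⟨
  (suc x + suc k) C (suc k + suc k) ∎

prefixSum-binom₁-id-closed : ∀ k x → prefixSum (binom₁ id k) x ≡ (x + k) C (k + k)
prefixSum-binom₁-id-closed zero    zero    = refl
prefixSum-binom₁-id-closed zero    (suc x) = trans (prefixSum-suc (binom₁ id 0) x) (prefixSum-binom₁-id-closed zero x)
prefixSum-binom₁-id-closed (suc k) =
  prefixSum-binom₁-id-closed-step k (binom₁-id-closed-step k (prefixSum-binom₁-id-closed k))

binom₁-id-closed : ∀ k x → binom₁ id (suc k) x ≡ (x + k) C suc (k + k)
binom₁-id-closed k = binom₁-id-closed-step k (prefixSum-binom₁-id-closed k)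

g₁ : ℕ → ℕ
g₁ x = if in12 x then 1 else 0

binom₁-g₁-one : ∀ k → binom₁ g₁ (suc k) 1 ≡ binom₁ g₁ k 0
binom₁-g₁-one k = trans (+-identityʳ _) (*-identityˡ _)

binom₁-g₁-suc : ∀ k y → binom₁ g₁ (suc k) (suc (suc y)) ≡ binom₁ g₁ k (suc y) + binom₁ g₁ k y
binom₁-g₁-suc k y = cong₂ _+_ (*-identityˡ (binom₁ g₁ k (suc y)))
  (trans (cong₂ _+_ (*-identityˡ (binom₁ g₁ k y)) (sum-map-applyUpTo-zero _ (λ a → 3 + a) (λ _ → refl) y)) (+-identityʳ _))

binom₁-g₁-vanish : ∀ k n → k + k < n → binom₁ g₁ k n ≡ 0
binom₁-g₁-vanish zero    (suc n)       _                  = refl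
binom₁-g₁-vanish (suc k) (suc zero)    (s≤s ())
binom₁-g₁-vanish (suc k) (suc (suc y)) (s≤s (s≤s 2k+1≤y)) =
  trans (binom₁-g₁-suc k y) (cong₂ _+_ (binom₁-g₁-vanish k (suc y) (m<n⇒m<1+n 2k<y))
                                        (binom₁-g₁-vanish k y 2k<y))
  where
  2k<y : k + k < y
  2k<y = subst (_≤ y) (+-suc k k) 2k+1≤y

binom₁-g₁-closed : ∀ k n r → n + r ≡ k + k → binom₁ g₁ k n ≡ k C r
binom₁-g₁-closed zero    zero             zero    refl = refl
binom₁-g₁-closed (suc k) zero             r       e    =
  sym (k>n⇒nCk≡0 (subst (suc k <_) (sym e) (s≤s (m≤n+m (suc k) k))))
binom₁-g₁-closed (suc k) (suc zero)       r       e    = begin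
  binom₁ g₁ (suc k) 1                  ≡⟨ binom₁-g₁-one k ⟩
  binom₁ g₁ k 0                        ≡⟨ binom₁-g₁-closed k 0 (k + k) refl ⟩
  k C (k + k)                          ≡⟨ +-identityʳ _ ⟨
  k C (k + k) + 0                      ≡⟨ cong (k C (k + k) +_) (k>n⇒nCk≡0 (s≤s (m≤m+n k k))) ⟨
  k C (k + k) + k C suc (k + k)        ≡⟨ nCk+nC[k+1]≡[n+1]C[k+1] k (k + k) ⟩
  suc k C suc (k + k)                  ≡⟨ cong (suc k C_) (trans (suc-injective e) (+-suc k k)) ⟨
  suc k C r                            ∎
binom₁-g₁-closed (suc k) (suc (suc y))    zero    e    = begin
  binom₁ g₁ (suc k) (suc (suc y))      ≡⟨ binom₁-g₁-suc k y ⟩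
  binom₁ g₁ k (suc y) + binom₁ g₁ k y  ≡⟨ cong₂ _+_ (binom₁-g₁-vanish k (suc y) (s≤s (≤-reflexive (sym y≡2k))))
                                                   (binom₁-g₁-closed k y 0 (trans (+-identityʳ y) y≡2k)) ⟩
  k C 0                                ∎
  where
  y≡2k : y ≡ k + k
  y≡2k = suc-injective (trans (sym (+-identityʳ (suc y))) (trans (suc-injective e) (+-suc k k)))
binom₁-g₁-closed (suc k) (suc (suc y))    (suc r) e    =
  trans (binom₁-g₁-suc k y) (trans (cong₂ _+_ (binom₁-g₁-closed k (suc y) r (trans (sym (+-suc y r)) e′))
                                              (binom₁-g₁-closed k y (suc r) e′))
                                   (nCk+nC[k+1]≡[n+1]C[k+1] k r))
  where
  e′ : y + suc r ≡ k + k
  e′ = suc-injective (trans (suc-injective e) (+-suc k k))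

g≡∏g₁ : ∀ {N} (v : Vec ℕ N) → g v ≡ ∏ g₁ v
g≡∏g₁ []                        = refl
g≡∏g₁ (zero ∷ v)                = refl
g≡∏g₁ (suc zero ∷ v)            = trans (g≡∏g₁ v) (sym (+-identityʳ _))
g≡∏g₁ (suc (suc zero) ∷ v)      = trans (g≡∏g₁ v) (sym (+-identityʳ _))
g≡∏g₁ (suc (suc (suc x)) ∷ v)   = refl

binom-cong : ∀ {N} {h h′ : Vec ℕ N → ℕ} → (∀ v → h v ≡ h′ v) → ∀ k v → binom h k v ≡ binom h′ k v
binom-cong h≗h′ zero    v = refl
binom-cong h≗h′ (suc k) v =
  cong sum (map-cong (λ m → cong₂ _*_ (h≗h′ m) (binom-cong h≗h′ k (v -ᵥ m))) (below v))

-- No conversion is needed: fprod is definitionally ∏ id.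
binom-fprod-diagonal : ∀ k c N → binom fprod k (c ·ᵥ 𝟏 N) ≡ binom₁ id k c ^ N
binom-fprod-diagonal = binom-∏-diagonal id

binom-g-diagonal : ∀ k c N → binom g k (c ·ᵥ 𝟏 N) ≡ binom₁ g₁ k c ^ N
binom-g-diagonal k c N = trans (binom-cong g≡∏g₁ k (c ·ᵥ 𝟏 N)) (binom-∏-diagonal g₁ k c N)

partialSum : (ℕ → ℕ) → ℕ → ℕ
partialSum t zero    = t 0
partialSum t (suc K) = partialSum t K + t (suc K)

partialSum-cong : ∀ {t u : ℕ → ℕ} → (∀ i → t i ≡ u i) → ∀ K → partialSum t K ≡ partialSum u K
partialSum-cong t≗u zero    = t≗u 0
partialSum-cong t≗u (suc K) = cong₂ _+_ (partialSum-cong t≗u K) (t≗u (suc K))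

partialSum-suc : ∀ t K → partialSum t (suc K) ≡ t 0 + partialSum (t ∘ suc) K
partialSum-suc t zero    = refl
partialSum-suc t (suc K) = trans (cong (_+ t (suc (suc K))) (partialSum-suc t K)) (+-assoc (t 0) _ _)

partialSum-drop : ∀ (t u : ℕ → ℕ) d → (∀ i → i < d → t i ≡ 0) → (∀ j → t (d + j) ≡ u j) →
  ∀ K → partialSum t (d + K) ≡ partialSum u K
partialSum-drop t u zero    _     shift K = partialSum-cong shift K
partialSum-drop t u (suc d) front shift K =
  trans (partialSum-suc t (d + K))
        (cong₂ _+_ (front 0 (s≤s z≤n)) (partialSum-drop (t ∘ suc) u d (λ i → front (suc i) ∘ s≤s) shift K))

partialSum-stable : ∀ (u : ℕ → ℕ) n → (∀ j → n < j → u j ≡ 0) → ∀ j → partialSum u (n + j) ≡ partialSum u n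
partialSum-stable u n tail zero    = cong (partialSum u) (+-identityʳ n)
partialSum-stable u n tail (suc j) = begin
  partialSum u (n + suc j)               ≡⟨ cong (partialSum u) (+-suc n j) ⟩
  partialSum u (n + j) + u (suc (n + j)) ≡⟨ cong₂ _+_ (partialSum-stable u n tail j) (tail _ (s≤s (m≤m+n n j))) ⟩
  partialSum u n + 0                     ≡⟨ +-identityʳ _ ⟩
  partialSum u n                         ∎

cPartial≡partialSum : ∀ {N} (h : Vec ℕ N → ℕ) K v → cPartial h K v ≡ partialSum (λ k → binom h k v) K
cPartial≡partialSum h zero    v = refl
cPartial≡partialSum h (suc K) v = cong (_+ binom h (suc K) v) (cPartial≡partialSum h K v)

hasSum-of-shifted-support : ∀ {N} (h : Vec ℕ N → ℕ) v d n (u : ℕ → ℕ) →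
  (∀ k → k < d → binom h k v ≡ 0) → (∀ j → binom h (d + j) v ≡ u j) → (∀ j → n < j → u j ≡ 0) →
  HasSum h v (partialSum u n)
hasSum-of-shifted-support h v d n u front shift tail = d + n , converged
  where
  t : ℕ → ℕ
  t k = binom h k v
  converged : ∀ K → d + n ≤ K → cPartial h K v ≡ partialSum u n
  converged K d+n≤K with m≤n⇒∃[o]m+o≡n d+n≤K
  ... | j , refl = begin
    cPartial h (d + n + j) v        ≡⟨ cPartial≡partialSum h (d + n + j) v ⟩
    partialSum t (d + n + j)        ≡⟨ cong (partialSum t) (+-assoc d n j) ⟩
    partialSum t (d + (n + j))      ≡⟨ partialSum-drop t u d front shift (n + j) ⟩
    partialSum u (n + j)            ≡⟨ partialSum-stable u n tail j ⟩
    partialSum u n                  ∎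

2*[1+m]∸1≡1+[m+m] : ∀ m → 2 * suc m ∸ 1 ≡ suc (m + m)
2*[1+m]∸1≡1+[m+m] m = trans (cong (λ n → m + suc n) (+-identityʳ m)) (+-suc m m)

theorem16 : (N : ℕ) → 1 ≤ N → (ℓ : ℕ) → 0 < ℓ →
    Σ ℕ λ a → HasSum fprod (ℓ ·ᵥ 𝟏 N) a × HasSum g ((2 * ℓ ∸ 1) ·ᵥ 𝟏 N) a
theorem16 (suc N) _ (suc m) _ =
  partialSum s m ,
  hasSum-of-shifted-support fprod _ 1 m s fprod-front fprod-shift s-tail ,
  subst (λ n → HasSum g (n ·ᵥ 𝟏 (suc N)) (partialSum s m)) (sym (2*[1+m]∸1≡1+[m+m] m))
        (hasSum-of-shifted-support g _ (suc m) m s g-front g-shift s-tail)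
  where
  s : ℕ → ℕ
  s i = ((suc m + i) C suc (i + i)) ^ suc N
  s-tail : ∀ i → m < i → s i ≡ 0
  s-tail i m<i = cong (_^ suc N) (k>n⇒nCk≡0 (s≤s (+-monoˡ-< i m<i)))
  fprod-front : ∀ k → k < 1 → binom fprod k (suc m ·ᵥ 𝟏 (suc N)) ≡ 0
  fprod-front zero    _         = binom-fprod-diagonal 0 (suc m) (suc N)
  fprod-front (suc k) (s≤s ())
  fprod-shift : ∀ i → binom fprod (1 + i) (suc m ·ᵥ 𝟏 (suc N)) ≡ s i
  fprod-shift i = trans (binom-fprod-diagonal (suc i) (suc m) (suc N)) (cong (_^ suc N) (binom₁-id-closed i (suc m)))
  g-front : ∀ k → k < suc m → binom g k (suc (m + m) ·ᵥ 𝟏 (suc N)) ≡ 0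
  g-front k (s≤s k≤m) = trans (binom-g-diagonal k _ (suc N))
    (cong (_^ suc N) (binom₁-g₁-vanish k _ (s≤s (+-mono-≤ k≤m k≤m))))
  g-shift : ∀ i → binom g (suc m + i) (suc (m + m) ·ᵥ 𝟏 (suc N)) ≡ s i
  g-shift i = trans (binom-g-diagonal (suc m + i) _ (suc N))
    (cong (_^ suc N) (binom₁-g₁-closed (suc m + i) (suc (m + m)) (suc (i + i)) (degrees-match m i)))
    where
    degrees-match : ∀ m i → suc (m + m) + suc (i + i) ≡ (suc m + i) + (suc m + i)
    degrees-match = solve-∀
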